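{- Let $n,d,k$ be positive integers and $\gamma\ge 0$. Let $G'_1,G'_2$ be two graphs, each on $n$ vertices with maximum degree at most $d$, each consisting entirely of connected components with at most $k$ vertices. If $\|\mathrm{cnt}(G'_1)-\mathrm{cnt}(G'_2)\|_1\le\gamma n$, then $\mathrm{dist}(G'_1,G'_2)\le\gamma k d$.
   Context: For a graph $G'$ whose connected components all have at most $k$ vertices, and for a connected unlabeled graph $F$ with at most $k$ vertices, $\mathrm{cnt}(G',F)$ is the number of connected components of $G'$ isomorphic to $F$. The vector $\mathrm{cnt}(G')$ collects these counts; it is indexed by all isomorphism classes of connected graphs on at most $k$ vertices. For two $n$-vertex graphs of maximum degree at most $d$, $\mathrm{dist}(G'_1,G'_2)$ is the minimum number of edge insertions and deletions needed to turn $G'_1$ into a graph isomorphic to $G'_2$, divided by $dn$.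
   Formalization: The parameter γ ranges over the nonnegative rationals. -}

module Defs where

open import Data.Bool using (Bool; true; false; if_then_else_; _xor_; _∧_; T)
open import Data.Nat using (ℕ; zero; suc; _≤_; NonZero; _*_)
open import Data.Nat.Properties using (m*n≢0)
open import Data.Fin using (Fin; _<?_)
import Data.Fin
import Data.Rational
open import Data.Fin.Permutation using (Permutation′; _⟨$⟩ʳ_)
open import Data.List using (List; length; map; allFin)
open import Data.Nat.ListAction using (sum)
open import Data.List.Relation.Unary.All using (All)
open import Data.List.Relation.Unary.Any using (Any)
open import Data.List.Relation.Unary.AllPairs using (AllPairs)
open import Data.List.Relation.Binary.Pointwise using (Pointwise)
open import Relation.Nullary using (¬_)
open import Data.Nat using (∣_-_∣)
open import Data.List using (zipWith)
open import Data.List.Relation.Unary.Unique.Propositional using (Unique)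
open import Data.List.Membership.Propositional using (_∈_)
open import Data.Product using (Σ; ∃; _×_; _,_)
open import Data.Integer using (+_)
open import Data.Rational using (ℚ; _/_)
open import Function.Bundles using (_↔_; Inverse; _⇔_)
open import Relation.Nullary.Decidable using (⌊_⌋)
open import Relation.Binary.PropositionalEquality using (_≡_)
open import Relation.Binary.Construct.Closure.ReflexiveTransitive using (Star)

record Graph (n : ℕ) : Set where
  field
    adj    : Fin n → Fin n → Bool
    sym    : ∀ i j → adj i j ≡ adj j i
    irrefl : ∀ i → adj i i ≡ false
open Graph public

sumFin : ∀ {n} → (Fin n → ℕ) → ℕ
sumFin {n} f = sum (map f (allFin n))

bit : Bool → ℕ
bit true  = 1
bit false = 0

degree : ∀ {n} → Graph n → Fin n → ℕ
degree G v = sumFin (λ u → bit (adj G v u))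

MaxDegreeAtMost : ∀ {n} → ℕ → Graph n → Set
MaxDegreeAtMost d G = ∀ v → degree G v ≤ d

Reach : ∀ {n} → Graph n → Fin n → Fin n → Set
Reach G = Star (λ i j → T (adj G i j))

Connected : ∀ {n} → Graph n → Set
Connected G = ∀ i j → Reach G i j

ComponentsAtMost : ∀ {n} → ℕ → Graph n → Set
ComponentsAtMost k G =
  ∀ v (xs : List _) → Unique xs → All (Reach G v) xs → length xs ≤ k

Iso : ∀ {m m'} → Graph m → Graph m' → Set
Iso {m} {m'} F F' = Σ (Fin m ↔ Fin m') λ f →
  ∀ i j → adj F i j ≡ adj F' (Inverse.to f i) (Inverse.to f j)

ComponentIso : ∀ {n m} → Graph n → Fin n → Graph m → Set
ComponentIso {n} {m} G v F = Σ (Fin m → Fin n) λ f →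
  (∀ i j → f i ≡ f j → i ≡ j) ×
  (∀ u → (Reach G v u ⇔ ∃ λ i → f i ≡ u)) ×
  (∀ i j → adj F i j ≡ adj G (f i) (f j))

LeastInComponent : ∀ {n} → Graph n → Fin n → Set
LeastInComponent G v = ∀ u → Reach G v u → Data.Fin._≤_ v u

-- cnt(G,F) = c : the number of connected components of G isomorphic to F is c
-- (components are identified with their least vertex)
Cnt : ∀ {n m} → Graph n → Graph m → ℕ → Set
Cnt {n} G F c = Σ (List (Fin n)) λ xs →
  Unique xs × (∀ v → (v ∈ xs ⇔ (LeastInComponent G v × ComponentIso G v F))) × length xs ≡ c

-- a list containing exactly one representative of each isomorphism class
-- of connected graphs on at most k vertices (the index set of the vector cnt)
Graphs : Set
Graphs = Σ ℕ Graph

IsoG : Graphs → Graphs → Set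
IsoG (_ , F) (_ , F') = Iso F F'

Representatives : ℕ → List Graphs → Set
Representatives k Fs =
  All (λ { (m , F) → 1 ≤ m × m ≤ k × Connected F }) Fs ×
  AllPairs (λ F F' → ¬ IsoG F F') Fs ×
  (∀ m (F : Graph m) → 1 ≤ m → m ≤ k → Connected F → Any (IsoG (m , F)) Fs)

CntVec : ∀ {n} → Graph n → List Graphs → List ℕ → Set
CntVec G Fs cs = Pointwise (λ { (_ , F) c → Cnt G F c }) Fs cs

l1 : List ℕ → List ℕ → ℕ
l1 cs ds = sum (zipWith ∣_-_∣ cs ds)

-- number of edge insertions/deletions turning G1 into the graph π*G2 ≅ G2
-- (pairs i < j on which G1 and π*G2 disagree)
edits : ∀ {n} → Graph n → Graph n → Permutation′ n → ℕ
edits G₁ G₂ π = sumFin λ i → sumFin λ j →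
  bit (⌊ i <? j ⌋ ∧ (adj G₁ i j xor adj G₂ (π ⟨$⟩ʳ i) (π ⟨$⟩ʳ j)))

normalise : (d n : ℕ) .{{_ : NonZero d}} .{{_ : NonZero n}} → ℕ → ℚ
normalise d n e = (+ e / (d * n)) {{m*n≢0 d n}}

-- dist(G1,G2) ≤ δ  :⇔  some relabelling π achieves normalised edit count ≤ δ
-- (dist is the minimum over π, so this is exactly "the minimum is ≤ δ")
DistAtMost : ∀ {n} (d : ℕ) .{{_ : NonZero d}} .{{_ : NonZero n}} →
  Graph n → Graph n → ℚ → Set
DistAtMost {n} d G₁ G₂ δ = ∃ λ π → normalise d n (edits G₁ G₂ π) Data.Rational.≤ δ

-- Group the components of G₁ and G₂ by their isomorphism type F in Fs. Within each type,
-- pair the components of G₁ with those of G₂ and map each pair onto each other through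
-- their isomorphisms with F; these vertices then keep their neighbourhoods exactly. The
-- unpaired components number Σ_F |cnt(G₁,F) − cnt(G₂,F)| ≤ γn, so they cover at most γnk
-- vertices in total, as many in G₁ as in G₂, and an arbitrary bijection between the two
-- leftover sets completes a relabelling.

module Submission where

module Combinatorics where

  open import Data.Bool using (Bool; true; false; T; _∧_; _xor_)
  open import Data.Empty using (⊥-elim)
  open import Data.Fin using (Fin; zero; suc)
  import Data.Fin as Fin
  import Data.Fin.Properties as Fin
  open import Data.Fin.Permutation using (Permutation′; _⟨$⟩ʳ_; inverseʳ)
  open import Data.List using (List; []; _∷_; _++_; map; length; lookup; allFin; filter; concatMap; zip; drop)
  open import Data.List.Properties using (map-cong; length-map; length-++; length-drop; length-tabulate; map-++; map-∘; concatMap-cong; concatMap-map; map-concatMap; concatMap-++; ++-assoc)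
  open import Data.List.Membership.Propositional using (_∈_; find; lose)
  open import Data.List.Membership.Propositional.Properties
  open import Data.List.Membership.Propositional.Properties.WithK using (unique∧set⇒bag)
  open import Data.List.Relation.Binary.BagAndSetEquality using (∼bag⇒↭)
  open import Data.List.Relation.Binary.Pointwise using ([]; _∷_)
  open import Data.List.Relation.Binary.Permutation.Propositional using (_↭_; ↭-refl; ↭-sym; ↭-trans; ↭-reflexive; ↭⇒↭ₛ; module PermutationReasoning)
  open import Data.List.Relation.Binary.Permutation.Propositional.Properties using (∈-resp-↭; ↭-length; ++⁺ˡ; shifts)
  import Data.List.Relation.Binary.Permutation.Propositional.Properties as Perm
  import Data.List.Relation.Binary.Permutation.Setoid.Properties as Permₛ
  open import Data.List.Relation.Unary.All as All using (All; []; _∷_)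
  import Data.List.Relation.Unary.All.Properties as All
  open import Data.List.Relation.Unary.Any as Any using (Any; here; there)
  import Data.List.Relation.Unary.Any.Properties as Any
  open import Data.List.Relation.Unary.AllPairs as AllPairs using (AllPairs; []; _∷_)
  import Data.List.Relation.Unary.AllPairs.Properties as AllPairs
  open import Data.List.Relation.Binary.Disjoint.Propositional using (Disjoint)
  open import Data.List.Relation.Unary.Unique.Propositional using (Unique)
  import Data.List.Relation.Unary.Unique.Propositional.Properties as Unique
  open import Data.Nat using (ℕ; zero; suc; _+_; _*_; _∸_; _≤_; z≤n; s≤s; ∣_-_∣)
  open import Data.Nat.Properties
  open import Algebra.Properties.CommutativeSemigroup +-commutativeSemigroup using () renaming (interchange to +-interchange)
  open import Data.Nat.ListAction using (sum)
  open import Data.Nat.ListAction.Properties using (sum-++; sum-↭)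
  open import Data.Product using (Σ; ∃; _×_; _,_; proj₁; proj₂)
  open import Data.Sum using (_⊎_; inj₁; inj₂)
  open import Function using (_∘_)
  open import Function.Bundles using (Inverse; Injection; Equivalence; _⇔_; mk⇔; mk↔ₛ′)
  open import Function.Properties.Inverse using (↔⇒↣)
  open import Relation.Binary.PropositionalEquality
  open import Relation.Nullary using (¬_; Dec; yes; no)
  open import Relation.Nullary.Decidable as Dec using (T?; _⊎-dec_; _×-dec_; ⌊_⌋)
  open import Relation.Binary.Construct.Closure.ReflexiveTransitive using (ε; _◅_; _◅◅_)

  open import Defs hiding (sym)

  module _ {a} {A : Set a} where

    Unique⇒lookup-injective : ∀ {xs : List A} → Unique xs → ∀ i j → lookup xs i ≡ lookup xs j → i ≡ j
    Unique⇒lookup-injective (_ ∷ _) zero zero _ = refl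
    Unique⇒lookup-injective (x∉ ∷ _) zero (suc j) eq = ⊥-elim (All.lookup x∉ (∈-lookup j) eq)
    Unique⇒lookup-injective (x∉ ∷ _) (suc i) zero eq = ⊥-elim (All.lookup x∉ (∈-lookup i) (sym eq))
    Unique⇒lookup-injective (_ ∷ u) (suc i) (suc j) eq = cong suc (Unique⇒lookup-injective u i j eq)

    Unique-map⇒injective : ∀ {b} {B : Set b} (f : A → B) {xs : List A} → Unique (map f xs) →
      ∀ {x y} → x ∈ xs → y ∈ xs → f x ≡ f y → x ≡ y
    Unique-map⇒injective f (_ ∷ _) (here refl) (here refl) _ = refl
    Unique-map⇒injective f (fx∉ ∷ _) (here refl) (there y∈) eq = ⊥-elim (All.lookup fx∉ (∈-map⁺ f y∈) eq)
    Unique-map⇒injective f (fy∉ ∷ _) (there x∈) (here refl) eq = ⊥-elim (All.lookup fy∉ (∈-map⁺ f x∈) (sym eq))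
    Unique-map⇒injective f (_ ∷ u) (there x∈) (there y∈) eq = Unique-map⇒injective f u x∈ y∈ eq

  ↭allFin⇒Unique : ∀ {n} {xs : List (Fin n)} → xs ↭ allFin n → Unique xs
  ↭allFin⇒Unique p = Permₛ.Unique-resp-↭ (setoid _) (↭⇒↭ₛ (↭-sym p)) (Unique.allFin⁺ _)

  Unique∧complete⇒↭allFin : ∀ {n} {xs : List (Fin n)} → Unique xs → (∀ x → x ∈ xs) → xs ↭ allFin n
  Unique∧complete⇒↭allFin {n} u complete =
    ∼bag⇒↭ (unique∧set⇒bag u (Unique.allFin⁺ n) (mk⇔ (λ _ → ∈-allFin _) (λ _ → complete _)))

  module _ {a b} {A : Set a} {B : Set b} where

    map-proj₁-zip-++-drop : ∀ (xs : List A) (ys : List B) → map proj₁ (zip xs ys) ++ drop (length ys) xs ≡ xs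
    map-proj₁-zip-++-drop [] [] = refl
    map-proj₁-zip-++-drop [] (y ∷ ys) = refl
    map-proj₁-zip-++-drop (x ∷ xs) [] = refl
    map-proj₁-zip-++-drop (x ∷ xs) (y ∷ ys) = cong (x ∷_) (map-proj₁-zip-++-drop xs ys)

    map-proj₂-zip-++-drop : ∀ (xs : List A) (ys : List B) → map proj₂ (zip xs ys) ++ drop (length xs) ys ≡ ys
    map-proj₂-zip-++-drop [] [] = refl
    map-proj₂-zip-++-drop [] (y ∷ ys) = refl
    map-proj₂-zip-++-drop (x ∷ xs) [] = refl
    map-proj₂-zip-++-drop (x ∷ xs) (y ∷ ys) = cong (y ∷_) (map-proj₂-zip-++-drop xs ys)

    map-proj₁-zip : ∀ (xs : List A) (ys : List B) → length xs ≡ length ys → map proj₁ (zip xs ys) ≡ xs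
    map-proj₁-zip [] [] _ = refl
    map-proj₁-zip (x ∷ xs) (y ∷ ys) eq = cong (x ∷_) (map-proj₁-zip xs ys (suc-injective eq))

    map-proj₂-zip : ∀ (xs : List A) (ys : List B) → length xs ≡ length ys → map proj₂ (zip xs ys) ≡ ys
    map-proj₂-zip [] [] _ = refl
    map-proj₂-zip (x ∷ xs) (y ∷ ys) eq = cong (y ∷_) (map-proj₂-zip xs ys (suc-injective eq))

    concatMap-++-↭ : ∀ (f g : A → List B) xs → concatMap (λ x → f x ++ g x) xs ↭ concatMap f xs ++ concatMap g xs
    concatMap-++-↭ f g [] = ↭-refl
    concatMap-++-↭ f g (x ∷ xs) = begin
      (f x ++ g x) ++ concatMap (λ x → f x ++ g x) xs ≡⟨ ++-assoc (f x) (g x) _ ⟩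
      f x ++ g x ++ concatMap (λ x → f x ++ g x) xs   ↭⟨ ++⁺ˡ (f x) (++⁺ˡ (g x) (concatMap-++-↭ f g xs)) ⟩
      f x ++ g x ++ concatMap f xs ++ concatMap g xs  ↭⟨ ++⁺ˡ (f x) (shifts (g x) (concatMap f xs)) ⟩
      f x ++ concatMap f xs ++ g x ++ concatMap g xs  ≡⟨ ++-assoc (f x) _ _ ⟨
      (f x ++ concatMap f xs) ++ g x ++ concatMap g xs ∎
      where open PermutationReasoning

    length-concatMap : ∀ (f : A → List B) xs → length (concatMap f xs) ≡ sum (map (length ∘ f) xs)
    length-concatMap f [] = refl
    length-concatMap f (x ∷ xs) = trans (length-++ (f x)) (cong (length (f x) +_) (length-concatMap f xs))

  module _ {a} {A : Set a} where

    sum-map-+ : ∀ (f g : A → ℕ) xs → sum (map (λ x → f x + g x) xs) ≡ sum (map f xs) + sum (map g xs)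
    sum-map-+ f g [] = refl
    sum-map-+ f g (x ∷ xs) = trans (cong (f x + g x +_) (sum-map-+ f g xs)) (+-interchange (f x) (g x) _ _)

    sum-map-*ʳ : ∀ (f : A → ℕ) c xs → sum (map (λ x → f x * c) xs) ≡ sum (map f xs) * c
    sum-map-*ʳ f c [] = refl
    sum-map-*ʳ f c (x ∷ xs) = trans (cong (f x * c +_) (sum-map-*ʳ f c xs)) (sym (*-distribʳ-+ c (f x) _))

    sum-map-mono-≤ : ∀ {f g : A → ℕ} xs → (∀ x → f x ≤ g x) → sum (map f xs) ≤ sum (map g xs)
    sum-map-mono-≤ [] _ = z≤n
    sum-map-mono-≤ (x ∷ xs) f≤g = +-mono-≤ (f≤g x) (sum-map-mono-≤ xs f≤g)

    sum-map-≤-length* : ∀ (f : A → ℕ) c xs → (∀ x → f x ≤ c) → sum (map f xs) ≤ length xs * c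
    sum-map-≤-length* f c [] _ = z≤n
    sum-map-≤-length* f c (x ∷ xs) f≤c = +-mono-≤ (f≤c x) (sum-map-≤-length* f c xs f≤c)

    sum-map-zero : ∀ (f : A → ℕ) xs → (∀ {x} → x ∈ xs → f x ≡ 0) → sum (map f xs) ≡ 0
    sum-map-zero f [] _ = refl
    sum-map-zero f (x ∷ xs) f≡0 = cong₂ _+_ (f≡0 (here refl)) (sum-map-zero f xs (f≡0 ∘ there))

  ∣m-n∣≡m∸n+n∸m : ∀ m n → ∣ m - n ∣ ≡ (m ∸ n) + (n ∸ m)
  ∣m-n∣≡m∸n+n∸m zero zero = refl
  ∣m-n∣≡m∸n+n∸m zero (suc n) = refl
  ∣m-n∣≡m∸n+n∸m (suc m) zero = sym (+-identityʳ (suc m))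
  ∣m-n∣≡m∸n+n∸m (suc m) (suc n) = ∣m-n∣≡m∸n+n∸m m n

  module _ {n : ℕ} (Q : List (Fin n × Fin n))
    (dom : map proj₁ Q ↭ allFin n) (cod : map proj₂ Q ↭ allFin n) where

    private
      inQ₁ : ∀ x → ∃ λ p → p ∈ Q × x ≡ proj₁ p
      inQ₁ x = ∈-map⁻ proj₁ (∈-resp-↭ (↭-sym dom) (∈-allFin x))

      inQ₂ : ∀ y → ∃ λ p → p ∈ Q × y ≡ proj₂ p
      inQ₂ y = ∈-map⁻ proj₂ (∈-resp-↭ (↭-sym cod) (∈-allFin y))

      to from : Fin n → Fin n
      to x = proj₂ (proj₁ (inQ₁ x))
      from y = proj₁ (proj₁ (inQ₂ y))

      to-∈ : ∀ {x y} → (x , y) ∈ Q → to x ≡ y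
      to-∈ {x} xy∈ with inQ₁ x
      ... | _ , p∈ , refl = cong proj₂ (Unique-map⇒injective proj₁ (↭allFin⇒Unique dom) p∈ xy∈ refl)

      from-∈ : ∀ {x y} → (x , y) ∈ Q → from y ≡ x
      from-∈ {y = y} xy∈ with inQ₂ y
      ... | _ , p∈ , refl = cong proj₁ (Unique-map⇒injective proj₂ (↭allFin⇒Unique cod) p∈ xy∈ refl)

      to-from : ∀ y → to (from y) ≡ y
      to-from y with inQ₂ y
      ... | _ , p∈ , refl = to-∈ p∈

      from-to : ∀ x → from (to x) ≡ x
      from-to x with inQ₁ x
      ... | _ , p∈ , refl = from-∈ p∈

    permutation-from-pairs : Σ (Permutation′ n) λ π → ∀ {x y} → (x , y) ∈ Q → π ⟨$⟩ʳ x ≡ y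
    permutation-from-pairs = mk↔ₛ′ to from to-from from-to , to-∈

  module Reachability {n : ℕ} (G : Graph n) where

    open import Data.List.Membership.DecPropositional (Fin._≟_ {n}) using (_∈?_)

    Reach-sym : ∀ {u v} → Reach G u v → Reach G v u
    Reach-sym ε = ε
    Reach-sym (_◅_ {j = w} e r) = Reach-sym r ◅◅ (subst T (Graph.sym G _ w) e ◅ ε)

    data Walk : Fin n → Fin n → List (Fin n) → Set where
      [_]  : ∀ v → Walk v v (v ∷ [])
      _∷_ : ∀ {v w u vs} → T (adj G v w) → Walk w u vs → Walk v u (v ∷ vs)

    Reach⇒Walk : ∀ {v u} → Reach G v u → ∃ (Walk v u)
    Reach⇒Walk ε = _ , [ _ ]
    Reach⇒Walk (e ◅ r) = _ , e ∷ proj₂ (Reach⇒Walk r)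

    Walk⇒All-Reach : ∀ {r v u vs} → Reach G r v → Walk v u vs → All (Reach G r) vs
    Walk⇒All-Reach r→v [ _ ] = r→v ∷ []
    Walk⇒All-Reach r→v (e ∷ w) = r→v ∷ Walk⇒All-Reach (r→v ◅◅ (e ◅ ε)) w

    SimpleWalk : Fin n → Fin n → Set
    SimpleWalk v u = ∃ λ vs → Walk v u vs × Unique vs

    simple-suffix : ∀ {v w u vs} → Walk w u vs → v ∈ vs → Unique vs → SimpleWalk v u
    simple-suffix [ _ ] (here refl) u = _ , [ _ ] , u
    simple-suffix (e ∷ w) (here refl) u = _ , e ∷ w , u
    simple-suffix (_ ∷ w) (there v∈) (_ ∷ u) = simple-suffix w v∈ u

    Walk⇒SimpleWalk : ∀ {v u vs} → Walk v u vs → SimpleWalk v u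
    Walk⇒SimpleWalk [ v ] = _ , [ v ] , [] ∷ []
    Walk⇒SimpleWalk {v} (e ∷ w) with Walk⇒SimpleWalk w
    ... | vs , w′ , u with v ∈? vs
    ...   | yes v∈ = simple-suffix w′ v∈ u
    ...   | no v∉ = _ , e ∷ w′ , All.tabulate (λ {x} x∈ v≡x → v∉ (subst (_∈ vs) (sym v≡x) x∈)) ∷ u

    ReachWithin : ℕ → Fin n → Fin n → Set
    ReachWithin zero v u = v ≡ u
    ReachWithin (suc t) v u = v ≡ u ⊎ ∃ λ w → T (adj G v w) × ReachWithin t w u

    ReachWithin? : ∀ t v u → Dec (ReachWithin t v u)
    ReachWithin? zero v u = v Fin.≟ u
    ReachWithin? (suc t) v u = (v Fin.≟ u) ⊎-dec Fin.any? (λ w → T? (adj G v w) ×-dec ReachWithin? t w u)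

    ReachWithin⇒Reach : ∀ t {v u} → ReachWithin t v u → Reach G v u
    ReachWithin⇒Reach zero refl = ε
    ReachWithin⇒Reach (suc t) (inj₁ refl) = ε
    ReachWithin⇒Reach (suc t) (inj₂ (_ , e , r)) = e ◅ ReachWithin⇒Reach t r

    Walk⇒ReachWithin : ∀ t {v u vs} → Walk v u vs → length vs ≤ suc t → ReachWithin t v u
    Walk⇒ReachWithin zero [ _ ] _ = refl
    Walk⇒ReachWithin zero (_ ∷ [ _ ]) (s≤s ())
    Walk⇒ReachWithin zero (_ ∷ (_ ∷ _)) (s≤s ())
    Walk⇒ReachWithin (suc t) [ _ ] _ = inj₁ refl
    Walk⇒ReachWithin (suc t) (e ∷ w) (s≤s l) = inj₂ (_ , e , Walk⇒ReachWithin t w l)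

    module _ {k : ℕ} (small : ComponentsAtMost k G) where

      -- The vertices of a simple walk lie in one component, so there are at most k of them.
      Reach⇒ReachWithin : ∀ {v u} → Reach G v u → ReachWithin k v u
      Reach⇒ReachWithin r with Walk⇒SimpleWalk (proj₂ (Reach⇒Walk r))
      ... | vs , w , u = Walk⇒ReachWithin k w (m≤n⇒m≤1+n (small _ vs u (Walk⇒All-Reach ε w)))

      Reach? : ∀ v u → Dec (Reach G v u)
      Reach? v u = Dec.map′ (ReachWithin⇒Reach k) Reach⇒ReachWithin (ReachWithin? k v u)

  least : ∀ {n p} {P : Fin n → Set p} → (∀ i → Dec (P i)) → ∀ {u} → P u →
    ∃ λ v → P v × (∀ w → P w → v Fin.≤ w)
  least {suc n} {P = P} P? {u} Pu with P? zero
  ... | yes P0 = zero , P0 , λ _ _ → z≤n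
  ... | no ¬P0 with u
  ...   | zero = ⊥-elim (¬P0 Pu)
  ...   | suc u′ with least (P? ∘ suc) Pu
  ...     | v , Pv , v-least = suc v , Pv , λ { zero P0 → ⊥-elim (¬P0 P0) ; (suc w) Pw → s≤s (v-least w Pw) }

  module Components {n : ℕ} (G : Graph n) where

    open Reachability G

    ComponentIso⇒Iso : ∀ {v m m′} {F : Graph m} {F′ : Graph m′} →
      ComponentIso G v F → ComponentIso G v F′ → Iso F F′
    ComponentIso⇒Iso {m = m} {m′} {F} {F′} (f , f-inj , f-onto , f-adj) (g , g-inj , g-onto , g-adj) =
      mk↔ₛ′ to from to-from from-to , λ i j → begin
        adj F i j                   ≡⟨ f-adj i j ⟩
        adj G (f i) (f j)           ≡⟨ cong₂ (adj G) (g∘to i) (g∘to j) ⟨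
        adj G (g (to i)) (g (to j)) ≡⟨ g-adj (to i) (to j) ⟨
        adj F′ (to i) (to j)        ∎
      where
      open ≡-Reasoning
      through-g : ∀ i → ∃ λ j → g j ≡ f i
      through-g i = Equivalence.to (g-onto (f i)) (Equivalence.from (f-onto (f i)) (i , refl))
      through-f : ∀ j → ∃ λ i → f i ≡ g j
      through-f j = Equivalence.to (f-onto (g j)) (Equivalence.from (g-onto (g j)) (j , refl))
      to : Fin m → Fin m′
      to i = proj₁ (through-g i)
      g∘to : ∀ i → g (to i) ≡ f i
      g∘to i = proj₂ (through-g i)
      from : Fin m′ → Fin m
      from j = proj₁ (through-f j)
      f∘from : ∀ j → f (from j) ≡ g j
      f∘from j = proj₂ (through-f j)
      to-from : ∀ j → to (from j) ≡ j
      to-from j = g-inj _ _ (trans (g∘to (from j)) (f∘from j))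
      from-to : ∀ i → from (to i) ≡ i
      from-to i = f-inj _ _ (trans (f∘from (to i)) (g∘to i))

    record Component {m : ℕ} (F : Graph m) : Set where
      field
        root       : Fin n
        root-least : LeastInComponent G root
        root-iso   : ComponentIso G root F

      embed : Fin m → Fin n
      embed = proj₁ root-iso

      embed-injective : ∀ {a b} → embed a ≡ embed b → a ≡ b
      embed-injective = proj₁ (proj₂ root-iso) _ _

      embed-adj : ∀ a b → adj G (embed a) (embed b) ≡ adj F a b
      embed-adj a b = sym (proj₂ (proj₂ (proj₂ root-iso)) a b)

      Reach⇔embed : ∀ u → Reach G root u ⇔ ∃ λ a → embed a ≡ u
      Reach⇔embed = proj₁ (proj₂ (proj₂ root-iso))

      vertices : List (Fin n)
      vertices = map embed (allFin m)

      vertices-unique : Unique vertices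
      vertices-unique = Unique.map⁺ embed-injective (Unique.allFin⁺ m)

      length-vertices : length vertices ≡ m
      length-vertices = trans (length-map embed (allFin m)) (length-tabulate _)

      Reach⇒∈vertices : ∀ {u} → Reach G root u → u ∈ vertices
      Reach⇒∈vertices {u} r with Equivalence.to (Reach⇔embed u) r
      ... | a , refl = ∈-map⁺ embed (∈-allFin a)

      ∈vertices⇒Reach : ∀ {u} → u ∈ vertices → Reach G root u
      ∈vertices⇒Reach u∈ with ∈-map⁻ embed u∈
      ... | a , _ , refl = Equivalence.from (Reach⇔embed _) (a , refl)

      neighbour-embedded : ∀ a {u} → T (adj G (embed a) u) → ∃ λ b → embed b ≡ u
      neighbour-embedded a {u} e =
        Equivalence.to (Reach⇔embed u) (Equivalence.from (Reach⇔embed _) (a , refl) ◅◅ (e ◅ ε))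

    open Component public

    ∈vertices⇒same-root : ∀ {m m′} {F : Graph m} {F′ : Graph m′} (c : Component F) (c′ : Component F′) {u} →
      u ∈ vertices c → u ∈ vertices c′ → root c ≡ root c′
    ∈vertices⇒same-root c c′ u∈c u∈c′ =
      Fin.≤-antisym (root-least c _ (r ◅◅ Reach-sym r′)) (root-least c′ _ (r′ ◅◅ Reach-sym r))
      where
      r = ∈vertices⇒Reach c u∈c
      r′ = ∈vertices⇒Reach c′ u∈c′

    same-root⇒Iso : ∀ {m m′} {F : Graph m} {F′ : Graph m′} (c : Component F) (c′ : Component F′) →
      root c ≡ root c′ → Iso F F′
    same-root⇒Iso {F = F} {F′} c c′ eq =
      ComponentIso⇒Iso {root c} {F = F} {F′} (root-iso c) (subst (λ v → ComponentIso G v F′) (sym eq) (root-iso c′))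

    module _ {k : ℕ} (small : ComponentsAtMost k G) where

      module InducedComponent (v : Fin n) where

        members : List (Fin n)
        members = filter (Reach? small v) (allFin n)

        members-unique : Unique members
        members-unique = Unique.filter⁺ (Reach? small v) (Unique.allFin⁺ n)

        size : ℕ
        size = length members

        graph : Graph size
        graph = record
          { adj    = λ a b → adj G (lookup members a) (lookup members b)
          ; sym    = λ a b → Graph.sym G _ _
          ; irrefl = λ a → Graph.irrefl G _
          }

        Reach⇒∈members : ∀ {u} → Reach G v u → u ∈ members
        Reach⇒∈members r = ∈-filter⁺ (Reach? small v) (∈-allFin _) r

        ∈members⇒Reach : ∀ {u} → u ∈ members → Reach G v u
        ∈members⇒Reach u∈ = proj₂ (∈-filter⁻ (Reach? small v) {xs = allFin n} u∈)

        lookup-index : ∀ {u} (u∈ : u ∈ members) → lookup members (Any.index u∈) ≡ u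
        lookup-index u∈ = sym (Any.lookup-index u∈)

        lift : ∀ a {x u} → lookup members a ≡ x → Reach G x u → (u∈ : u ∈ members) → Reach graph a (Any.index u∈)
        lift a a↦x ε u∈ =
          subst (Reach graph a) (Unique⇒lookup-injective members-unique a _ (trans a↦x (sym (lookup-index u∈)))) ε
        lift a refl (e ◅ r) u∈ = subst T (cong (adj G _) (sym (lookup-index y∈))) e ◅ lift _ (lookup-index y∈) r u∈
          where
          y∈ = Reach⇒∈members (∈members⇒Reach (∈-lookup a) ◅◅ (e ◅ ε))

        connected : Connected graph
        connected a b = subst (Reach graph a) (Unique⇒lookup-injective members-unique _ b (lookup-index b∈))
          (lift a refl (Reach-sym (∈members⇒Reach (∈-lookup a)) ◅◅ ∈members⇒Reach b∈) b∈)
          where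
          b∈ = ∈-lookup b

        1≤size : 1 ≤ size
        1≤size = ∈-length (Reach⇒∈members ε)

        size≤k : size ≤ k
        size≤k = small v members members-unique (All.tabulate ∈members⇒Reach)

        Iso⇒ComponentIso : ∀ {m} {F : Graph m} → Iso graph F → ComponentIso G v F
        Iso⇒ComponentIso {F = F} (h , h-adj) = f , f-injective , (λ u → mk⇔ (onto u) (into u)) , f-adj
          where
          f : Fin _ → Fin n
          f i = lookup members (Inverse.from h i)
          f-injective : ∀ i j → f i ≡ f j → i ≡ j
          f-injective i j eq = begin
            i                              ≡⟨ Inverse.strictlyInverseˡ h i ⟨
            Inverse.to h (Inverse.from h i) ≡⟨ cong (Inverse.to h) (Unique⇒lookup-injective members-unique _ _ eq) ⟩
            Inverse.to h (Inverse.from h j) ≡⟨ Inverse.strictlyInverseˡ h j ⟩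
            j                              ∎
            where open ≡-Reasoning
          onto : ∀ u → Reach G v u → ∃ λ i → f i ≡ u
          onto u r = Inverse.to h (Any.index u∈) , trans (cong (lookup members) (Inverse.strictlyInverseʳ h _)) (lookup-index u∈)
            where u∈ = Reach⇒∈members r
          into : ∀ u → (∃ λ i → f i ≡ u) → Reach G v u
          into u (i , refl) = ∈members⇒Reach (∈-lookup _)
          f-adj : ∀ i j → adj F i j ≡ adj G (f i) (f j)
          f-adj i j = sym (trans (h-adj (Inverse.from h i) (Inverse.from h j))
            (cong₂ (adj F) (Inverse.strictlyInverseˡ h i) (Inverse.strictlyInverseˡ h j)))

      component-of : ∀ {Fs} → Representatives k Fs → ∀ u →
        ∃ λ v → LeastInComponent G v × Reach G v u × Any (λ F → ComponentIso G v (proj₂ F)) Fs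
      component-of (_ , _ , represented) u with least (Reach? small u) ε
      ... | v , u→v , v-least =
        v , (λ w v→w → v-least w (u→v ◅◅ v→w)) , Reach-sym u→v ,
        Any.map (λ { {_ , F} → Iso⇒ComponentIso {F = F} }) (represented size graph 1≤size size≤k connected)
        where open InducedComponent v

  record Census {n m : ℕ} (G : Graph n) (F : Graph m) : Set where
    open Components G using (Component; root)
    field
      components     : List (Component F)
      roots-unique   : Unique (map root components)
      roots-complete : ∀ v → LeastInComponent G v → ComponentIso G v F → v ∈ map root components

  module _ {n m : ℕ} (G : Graph n) (F : Graph m) where

    open Components G using (Component; root)

    private
      components-rooted-at : (vs : List (Fin n)) →
        (∀ {v} → v ∈ vs → LeastInComponent G v × ComponentIso G v F) → List (Component F)
      components-rooted-at [] _ = []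
      components-rooted-at (v ∷ vs) h =
        record { root = v ; root-least = proj₁ (h (here refl)) ; root-iso = proj₂ (h (here refl)) }
        ∷ components-rooted-at vs (h ∘ there)

      roots-components-rooted-at : ∀ vs (h : ∀ {v} → v ∈ vs → LeastInComponent G v × ComponentIso G v F) →
        map root (components-rooted-at vs h) ≡ vs
      roots-components-rooted-at [] _ = refl
      roots-components-rooted-at (v ∷ vs) h = cong (v ∷_) (roots-components-rooted-at vs (h ∘ there))

    Cnt⇒Census : ∀ {c} → Cnt G F c → Σ (Census G F) λ C → length (Census.components C) ≡ c
    Cnt⇒Census (vs , vs-unique , vs-spec , length-vs) = census , length-components
      where
      cs = components-rooted-at vs (Equivalence.to (vs-spec _))
      roots≡vs = roots-components-rooted-at vs (λ {v} → Equivalence.to (vs-spec v))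
      census : Census G F
      census = record
        { components     = cs
        ; roots-unique   = subst Unique (sym roots≡vs) vs-unique
        ; roots-complete = λ v least iso → subst (v ∈_) (sym roots≡vs) (Equivalence.from (vs-spec v) (least , iso))
        }
      length-components : length cs ≡ _
      length-components = trans (sym (length-map root cs)) (trans (cong length roots≡vs) length-vs)

  record Class {n : ℕ} (G₁ G₂ : Graph n) (k : ℕ) : Set where
    field
      size    : ℕ
      shape   : Graph size
      size≤k  : size ≤ k
      census₁ : Census G₁ shape
      census₂ : Census G₂ shape

    components₁ : List (Components.Component G₁ shape)
    components₁ = Census.components census₁

    components₂ : List (Components.Component G₂ shape)
    components₂ = Census.components census₂

    key : Graphs
    key = size , shape

    discrepancy : ℕ
    discrepancy = ∣ length components₁ - length components₂ ∣

  open Class using (size; shape; size≤k; census₁; census₂; components₁; components₂; key; discrepancy)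

  module _ {n k : ℕ} (G₁ G₂ : Graph n) where

    classes-of : ∀ Fs → All (λ F → 1 ≤ proj₁ F × proj₁ F ≤ k × Connected (proj₂ F)) Fs →
      ∀ {c₁ c₂} → CntVec G₁ Fs c₁ → CntVec G₂ Fs c₂ →
      Σ (List (Class G₁ G₂ k)) λ classes → map key classes ≡ Fs × l1 c₁ c₂ ≡ sum (map discrepancy classes)
    classes-of [] [] [] [] = [] , refl , refl
    classes-of ((m , F) ∷ Fs) ((_ , m≤k , _) ∷ bounds) (cnt₁ ∷ cnts₁) (cnt₂ ∷ cnts₂)
      with Cnt⇒Census G₁ F cnt₁ | Cnt⇒Census G₂ F cnt₂ | classes-of Fs bounds cnts₁ cnts₂
    ... | C₁ , refl | C₂ , refl | classes , keys , l1≡ =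
      record { size = m ; shape = F ; size≤k = m≤k ; census₁ = C₁ ; census₂ = C₂ } ∷ classes ,
      cong ((m , F) ∷_) keys ,
      cong (_ +_) l1≡

  module VertexPartition {n k : ℕ} {G₁ G₂ : Graph n} (G : Graph n) (small : ComponentsAtMost k G)
    {Fs : List Graphs} (reps : Representatives k Fs)
    (classes : List (Class G₁ G₂ k)) (keys : map key classes ≡ Fs)
    (census : (t : Class G₁ G₂ k) → Census G (shape t)) where

    open Reachability G
    open Components G

    comps : (t : Class G₁ G₂ k) → List (Component (shape t))
    comps t = Census.components (census t)

    class-vertices : Class G₁ G₂ k → List (Fin n)
    class-vertices t = concatMap vertices (comps t)

    all-vertices : List (Fin n)
    all-vertices = concatMap class-vertices classes

    class-vertices-unique : ∀ t → Unique (class-vertices t)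
    class-vertices-unique t = Unique.concat⁺ {xss = map vertices (comps t)} (All.map⁺ (All.tabulate (λ {c} _ → vertices-unique c)))
      (AllPairs.map⁺ (AllPairs.map (λ {c} {c′} → disjoint {c} {c′}) (AllPairs.map⁻ (Census.roots-unique (census t)))))
      where
      disjoint : ∀ {c c′ : Component (shape t)} → root c ≢ root c′ → Disjoint (vertices c) (vertices c′)
      disjoint {c} {c′} roots≢ (u∈c , u∈c′) = roots≢ (∈vertices⇒same-root c c′ u∈c u∈c′)

    distinct-shapes : AllPairs (λ t t′ → ¬ Iso (shape t) (shape t′)) classes
    distinct-shapes = AllPairs.map⁻ (subst (AllPairs _) (sym keys) (proj₁ (proj₂ reps)))

    all-vertices-unique : Unique all-vertices
    all-vertices-unique = Unique.concat⁺ {xss = map class-vertices classes} (All.map⁺ (All.tabulate (λ {t} _ → class-vertices-unique t)))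
      (AllPairs.map⁺ (AllPairs.map disjoint distinct-shapes))
      where
      disjoint : ∀ {t t′} → ¬ Iso (shape t) (shape t′) → Disjoint (class-vertices t) (class-vertices t′)
      disjoint {t} {t′} ¬iso (u∈t , u∈t′) with find (∈-concatMap⁻ vertices {comps t} u∈t) | find (∈-concatMap⁻ vertices {comps t′} u∈t′)
      ... | c , _ , u∈c | c′ , _ , u∈c′ = ¬iso (same-root⇒Iso c c′ (∈vertices⇒same-root c c′ u∈c u∈c′))

    all-vertices-complete : ∀ u → u ∈ all-vertices
    all-vertices-complete u with component-of small reps u
    ... | v , v-least , v→u , iso-to-rep
      with find (Any.map⁻ (subst (Any _) (sym keys) iso-to-rep))
    ... | t , t∈ , iso with ∈-map⁻ root (Census.roots-complete (census t) v v-least iso)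
    ... | c , c∈ , refl = ∈-concatMap⁺ class-vertices (lose t∈ (∈-concatMap⁺ vertices (lose c∈ (Reach⇒∈vertices c v→u))))

    all-vertices↭allFin : all-vertices ↭ allFin n
    all-vertices↭allFin = Unique∧complete⇒↭allFin all-vertices-unique all-vertices-complete

    module Split (kept dropped : (t : Class G₁ G₂ k) → List (Component (shape t)))
      (kept++dropped : ∀ t → kept t ++ dropped t ≡ comps t) where

      kept-vertices dropped-vertices : List (Fin n)
      kept-vertices = concatMap (λ t → concatMap vertices (kept t)) classes
      dropped-vertices = concatMap (λ t → concatMap vertices (dropped t)) classes

      kept++dropped↭allFin : kept-vertices ++ dropped-vertices ↭ allFin n
      kept++dropped↭allFin = begin
        kept-vertices ++ dropped-vertices
          ↭⟨ concatMap-++-↭ (λ t → concatMap vertices (kept t)) (λ t → concatMap vertices (dropped t)) classes ⟨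
        concatMap (λ t → concatMap vertices (kept t) ++ concatMap vertices (dropped t)) classes
          ≡⟨ concatMap-cong class-split classes ⟩
        all-vertices
          ↭⟨ all-vertices↭allFin ⟩
        allFin n ∎
        where
        open PermutationReasoning
        class-split : ∀ t → concatMap vertices (kept t) ++ concatMap vertices (dropped t) ≡ class-vertices t
        class-split t = trans (sym (concatMap-++ vertices (kept t) (dropped t))) (cong (concatMap vertices) (kept++dropped t))

      length-kept+dropped : length kept-vertices + length dropped-vertices ≡ n
      length-kept+dropped = trans (sym (length-++ kept-vertices))
        (trans (↭-length kept++dropped↭allFin) (length-tabulate _))

      length-dropped-vertices : length dropped-vertices ≤ sum (map (λ t → length (dropped t)) classes) * k
      length-dropped-vertices = begin
        length dropped-vertices
          ≡⟨ length-concatMap (λ t → concatMap vertices (dropped t)) classes ⟩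
        sum (map (λ t → length (concatMap vertices (dropped t))) classes)
          ≤⟨ sum-map-mono-≤ classes class-bound ⟩
        sum (map (λ t → length (dropped t) * k) classes)
          ≡⟨ sum-map-*ʳ (λ t → length (dropped t)) k classes ⟩
        sum (map (λ t → length (dropped t)) classes) * k ∎
        where
        open ≤-Reasoning
        class-bound : ∀ t → length (concatMap vertices (dropped t)) ≤ length (dropped t) * k
        class-bound t = ≤-trans (≤-reflexive (length-concatMap vertices (dropped t)))
          (sum-map-≤-length* (length ∘ vertices) k (dropped t) (λ c → ≤-trans (≤-reflexive (length-vertices c)) (size≤k t)))

  permutation-injective : ∀ {n} (π : Permutation′ n) {x y} → π ⟨$⟩ʳ x ≡ π ⟨$⟩ʳ y → x ≡ y
  permutation-injective π = Injection.injective (↔⇒↣ π)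

  map-permutation-allFin : ∀ {n} (π : Permutation′ n) → map (π ⟨$⟩ʳ_) (allFin n) ↭ allFin n
  map-permutation-allFin {n} π = Unique∧complete⇒↭allFin
    (Unique.map⁺ (permutation-injective π) (Unique.allFin⁺ n))
    (λ z → subst (_∈ map (π ⟨$⟩ʳ_) (allFin n)) (inverseʳ π) (∈-map⁺ (π ⟨$⟩ʳ_) (∈-allFin _)))

  sumFin-permute : ∀ {n} (π : Permutation′ n) (f : Fin n → ℕ) → sumFin (λ j → f (π ⟨$⟩ʳ j)) ≡ sumFin f
  sumFin-permute {n} π f = trans (cong sum (map-∘ (allFin n))) (sum-↭ (Perm.map⁺ f (map-permutation-allFin π)))

  bit-∧-xor≤ : ∀ b x y → bit (b ∧ (x xor y)) ≤ bit x + bit y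
  bit-∧-xor≤ false x y = z≤n
  bit-∧-xor≤ true false false = z≤n
  bit-∧-xor≤ true false true = ≤-refl
  bit-∧-xor≤ true true false = s≤s z≤n
  bit-∧-xor≤ true true true = z≤n

  bit-∧-xor-self : ∀ b x → bit (b ∧ (x xor x)) ≡ 0
  bit-∧-xor-self false x = refl
  bit-∧-xor-self true false = refl
  bit-∧-xor-self true true = refl

  module _ {n : ℕ} (G₁ G₂ : Graph n) (π : Permutation′ n) where

    PreservedAt : Fin n → Set
    PreservedAt i = ∀ j → adj G₁ i j ≡ adj G₂ (π ⟨$⟩ʳ i) (π ⟨$⟩ʳ j)

    edits-at : Fin n → ℕ
    edits-at i = sumFin λ j → bit (⌊ i Fin.<? j ⌋ ∧ (adj G₁ i j xor adj G₂ (π ⟨$⟩ʳ i) (π ⟨$⟩ʳ j)))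

    edits-at≤degrees : ∀ i → edits-at i ≤ degree G₁ i + degree G₂ (π ⟨$⟩ʳ i)
    edits-at≤degrees i = begin
      edits-at i
        ≤⟨ sum-map-mono-≤ (allFin n) (λ j → bit-∧-xor≤ ⌊ i Fin.<? j ⌋ (adj G₁ i j) (adj G₂ (π ⟨$⟩ʳ i) (π ⟨$⟩ʳ j))) ⟩
      sumFin (λ j → bit (adj G₁ i j) + bit (adj G₂ (π ⟨$⟩ʳ i) (π ⟨$⟩ʳ j)))
        ≡⟨ sum-map-+ (λ j → bit (adj G₁ i j)) (λ j → bit (adj G₂ (π ⟨$⟩ʳ i) (π ⟨$⟩ʳ j))) (allFin n) ⟩
      degree G₁ i + sumFin (λ j → bit (adj G₂ (π ⟨$⟩ʳ i) (π ⟨$⟩ʳ j)))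
        ≡⟨ cong (degree G₁ i +_) (sumFin-permute π (bit ∘ adj G₂ (π ⟨$⟩ʳ i))) ⟩
      degree G₁ i + degree G₂ (π ⟨$⟩ʳ i) ∎
      where open ≤-Reasoning

    PreservedAt⇒edits-at≡0 : ∀ {i} → PreservedAt i → edits-at i ≡ 0
    PreservedAt⇒edits-at≡0 {i} preserved = sum-map-zero _ (allFin n) λ {j} _ → begin
      bit (⌊ i Fin.<? j ⌋ ∧ (adj G₁ i j xor adj G₂ (π ⟨$⟩ʳ i) (π ⟨$⟩ʳ j)))
        ≡⟨ cong (λ b → bit (⌊ i Fin.<? j ⌋ ∧ (adj G₁ i j xor b))) (preserved j) ⟨
      bit (⌊ i Fin.<? j ⌋ ∧ (adj G₁ i j xor adj G₁ i j))
        ≡⟨ bit-∧-xor-self ⌊ i Fin.<? j ⌋ (adj G₁ i j) ⟩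
      0 ∎
      where open ≡-Reasoning

    edits≤ : ∀ {d} → MaxDegreeAtMost d G₁ → MaxDegreeAtMost d G₂ →
      (M W : List (Fin n)) → M ++ W ↭ allFin n → (∀ {i} → i ∈ M → PreservedAt i) →
      edits G₁ G₂ π ≤ length W * (d + d)
    edits≤ {d} deg₁ deg₂ M W M++W↭ preserved = begin
      sum (map edits-at (allFin n))
        ≡⟨ sum-↭ (Perm.map⁺ edits-at M++W↭) ⟨
      sum (map edits-at (M ++ W))
        ≡⟨ trans (cong sum (map-++ edits-at M W)) (sum-++ (map edits-at M) (map edits-at W)) ⟩
      sum (map edits-at M) + sum (map edits-at W)
        ≡⟨ cong (_+ sum (map edits-at W)) (sum-map-zero edits-at M (PreservedAt⇒edits-at≡0 ∘ preserved)) ⟩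
      sum (map edits-at W)
        ≤⟨ sum-map-≤-length* edits-at (d + d) W edits-at≤2d ⟩
      length W * (d + d) ∎
      where
      open ≤-Reasoning
      edits-at≤2d : ∀ i → edits-at i ≤ d + d
      edits-at≤2d i = ≤-trans (edits-at≤degrees i) (+-mono-≤ (deg₁ i) (deg₂ (π ⟨$⟩ʳ i)))

  Bool-≡-from-T : ∀ {x y : Bool} → (T x → x ≡ y) → (T y → x ≡ y) → x ≡ y
  Bool-≡-from-T {true} x⇒ _ = x⇒ _
  Bool-≡-from-T {false} {true} _ y⇒ = y⇒ _
  Bool-≡-from-T {false} {false} _ _ = refl

  module _ {n : ℕ} {G₁ G₂ : Graph n} where

    private
      module C₁ = Components G₁
      module C₂ = Components G₂

    matched-component-preserved : ∀ {m} {F : Graph m} (π : Permutation′ n) (c₁ : C₁.Component F) (c₂ : C₂.Component F) →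
      (∀ b → π ⟨$⟩ʳ C₁.embed c₁ b ≡ C₂.embed c₂ b) → ∀ a → PreservedAt G₁ G₂ π (C₁.embed c₁ a)
    matched-component-preserved {F = F} π c₁ c₂ π∘e₁≡e₂ a j = Bool-≡-from-T
      (λ e → inside (C₁.neighbour-embedded c₁ a e))
      (λ e → inside (pull-back (C₂.neighbour-embedded c₂ a (subst (λ x → T (adj G₂ x (σ j))) (π∘e₁≡e₂ a) e))))
      where
      σ = π ⟨$⟩ʳ_
      e₁ = C₁.embed c₁
      e₂ = C₂.embed c₂
      inside : (∃ λ b → e₁ b ≡ j) → adj G₁ (e₁ a) j ≡ adj G₂ (σ (e₁ a)) (σ j)
      inside (b , refl) = begin
        adj G₁ (e₁ a) (e₁ b)         ≡⟨ C₁.embed-adj c₁ a b ⟩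
        adj F a b                    ≡⟨ C₂.embed-adj c₂ a b ⟨
        adj G₂ (e₂ a) (e₂ b)         ≡⟨ cong₂ (adj G₂) (π∘e₁≡e₂ a) (π∘e₁≡e₂ b) ⟨
        adj G₂ (σ (e₁ a)) (σ (e₁ b)) ∎
        where open ≡-Reasoning
      pull-back : (∃ λ b → e₂ b ≡ σ j) → ∃ λ b → e₁ b ≡ j
      pull-back (b , e₂b≡σj) = b , permutation-injective π (trans (π∘e₁≡e₂ b) e₂b≡σj)

  module Matching {n k : ℕ} {G₁ G₂ : Graph n}
    (small₁ : ComponentsAtMost k G₁) (small₂ : ComponentsAtMost k G₂)
    {Fs : List Graphs} (reps : Representatives k Fs)
    (classes : List (Class G₁ G₂ k)) (keys : map key classes ≡ Fs) where

    private
      module C₁ = Components G₁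
      module C₂ = Components G₂
      module V₁ = VertexPartition G₁ small₁ reps classes keys census₁
      module V₂ = VertexPartition G₂ small₂ reps classes keys census₂

      paired : (t : Class G₁ G₂ k) → List (C₁.Component (shape t) × C₂.Component (shape t))
      paired t = zip (components₁ t) (components₂ t)

    -- zip pairs up the first min(|components₁ t|, |components₂ t|) components of each class;
    -- the surplus on either side is dropped.
    module S₁ = V₁.Split (λ t → map proj₁ (paired t)) (λ t → drop (length (components₂ t)) (components₁ t))
      (λ t → map-proj₁-zip-++-drop (components₁ t) (components₂ t))
    module S₂ = V₂.Split (λ t → map proj₂ (paired t)) (λ t → drop (length (components₁ t)) (components₂ t))
      (λ t → map-proj₂-zip-++-drop (components₁ t) (components₂ t))

    vertex-pairs : (t : Class G₁ G₂ k) → C₁.Component (shape t) × C₂.Component (shape t) → List (Fin n × Fin n)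
    vertex-pairs t (c₁ , c₂) = map (λ a → C₁.embed c₁ a , C₂.embed c₂ a) (allFin (size t))

    class-pairs : Class G₁ G₂ k → List (Fin n × Fin n)
    class-pairs t = concatMap (vertex-pairs t) (paired t)

    matched-pairs : List (Fin n × Fin n)
    matched-pairs = concatMap class-pairs classes

    map-proj₁-matched-pairs : map proj₁ matched-pairs ≡ S₁.kept-vertices
    map-proj₁-matched-pairs = trans (map-concatMap proj₁ class-pairs classes) (concatMap-cong class-eq classes)
      where
      class-eq : ∀ t → map proj₁ (class-pairs t) ≡ concatMap C₁.vertices (map proj₁ (paired t))
      class-eq t = begin
        map proj₁ (class-pairs t)                        ≡⟨ map-concatMap proj₁ (vertex-pairs t) (paired t) ⟩
        concatMap (map proj₁ ∘ vertex-pairs t) (paired t) ≡⟨ concatMap-cong (λ _ → sym (map-∘ (allFin (size t)))) (paired t) ⟩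
        concatMap (C₁.vertices ∘ proj₁) (paired t)       ≡⟨ concatMap-map C₁.vertices proj₁ (paired t) ⟨
        concatMap C₁.vertices (map proj₁ (paired t))     ∎
        where open ≡-Reasoning

    map-proj₂-matched-pairs : map proj₂ matched-pairs ≡ S₂.kept-vertices
    map-proj₂-matched-pairs = trans (map-concatMap proj₂ class-pairs classes) (concatMap-cong class-eq classes)
      where
      class-eq : ∀ t → map proj₂ (class-pairs t) ≡ concatMap C₂.vertices (map proj₂ (paired t))
      class-eq t = begin
        map proj₂ (class-pairs t)                        ≡⟨ map-concatMap proj₂ (vertex-pairs t) (paired t) ⟩
        concatMap (map proj₂ ∘ vertex-pairs t) (paired t) ≡⟨ concatMap-cong (λ _ → sym (map-∘ (allFin (size t)))) (paired t) ⟩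
        concatMap (C₂.vertices ∘ proj₂) (paired t)       ≡⟨ concatMap-map C₂.vertices proj₂ (paired t) ⟨
        concatMap C₂.vertices (map proj₂ (paired t))     ∎
        where open ≡-Reasoning

    kept-preserved : (σ : Permutation′ n) → (∀ {x y} → (x , y) ∈ matched-pairs → σ ⟨$⟩ʳ x ≡ y) →
      ∀ {i} → i ∈ S₁.kept-vertices → PreservedAt G₁ G₂ σ i
    kept-preserved σ σ-follows i∈ with ∈-map⁻ proj₁ (subst (_ ∈_) (sym map-proj₁-matched-pairs) i∈)
    ... | _ , p∈ , refl with find (∈-concatMap⁻ class-pairs {classes} p∈)
    ... | t , t∈ , p∈t with find (∈-concatMap⁻ (vertex-pairs t) {paired t} p∈t)
    ... | (c₁ , c₂) , c₁c₂∈ , p∈c₁c₂ with ∈-map⁻ _ p∈c₁c₂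
    ... | a , _ , refl = matched-component-preserved σ c₁ c₂ (λ b → σ-follows (pair∈ b)) a
      where
      pair∈ : ∀ b → (C₁.embed c₁ b , C₂.embed c₂ b) ∈ matched-pairs
      pair∈ b = ∈-concatMap⁺ class-pairs (lose t∈ (∈-concatMap⁺ (vertex-pairs t) (lose c₁c₂∈ (∈-map⁺ _ (∈-allFin b)))))

    length-kept₁ : length S₁.kept-vertices ≡ length matched-pairs
    length-kept₁ = trans (cong length (sym map-proj₁-matched-pairs)) (length-map proj₁ matched-pairs)

    length-kept₂ : length S₂.kept-vertices ≡ length matched-pairs
    length-kept₂ = trans (cong length (sym map-proj₂-matched-pairs)) (length-map proj₂ matched-pairs)

    length-dropped-equal : length S₁.dropped-vertices ≡ length S₂.dropped-vertices
    length-dropped-equal = +-cancelˡ-≡ (length matched-pairs) _ _ (begin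
      length matched-pairs + length S₁.dropped-vertices    ≡⟨ cong (_+ _) length-kept₁ ⟨
      length S₁.kept-vertices + length S₁.dropped-vertices ≡⟨ S₁.length-kept+dropped ⟩
      n                                                    ≡⟨ S₂.length-kept+dropped ⟨
      length S₂.kept-vertices + length S₂.dropped-vertices ≡⟨ cong (_+ _) length-kept₂ ⟩
      length matched-pairs + length S₂.dropped-vertices    ∎)
      where open ≡-Reasoning

    all-pairs : List (Fin n × Fin n)
    all-pairs = matched-pairs ++ zip S₁.dropped-vertices S₂.dropped-vertices

    map-proj₁-all-pairs : map proj₁ all-pairs ≡ S₁.kept-vertices ++ S₁.dropped-vertices
    map-proj₁-all-pairs = trans (map-++ proj₁ matched-pairs _)
      (cong₂ _++_ map-proj₁-matched-pairs (map-proj₁-zip _ _ length-dropped-equal))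

    map-proj₂-all-pairs : map proj₂ all-pairs ≡ S₂.kept-vertices ++ S₂.dropped-vertices
    map-proj₂-all-pairs = trans (map-++ proj₂ matched-pairs _)
      (cong₂ _++_ map-proj₂-matched-pairs (map-proj₂-zip _ _ length-dropped-equal))

    relabelling : Σ (Permutation′ n) λ π → ∀ {x y} → (x , y) ∈ all-pairs → π ⟨$⟩ʳ x ≡ y
    relabelling = permutation-from-pairs all-pairs
      (↭-trans (↭-reflexive map-proj₁-all-pairs) S₁.kept++dropped↭allFin)
      (↭-trans (↭-reflexive map-proj₂-all-pairs) S₂.kept++dropped↭allFin)

    π : Permutation′ n
    π = proj₁ relabelling

    dropped-total : length S₁.dropped-vertices + length S₂.dropped-vertices ≤ sum (map discrepancy classes) * k
    dropped-total = begin
      length S₁.dropped-vertices + length S₂.dropped-vertices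
        ≤⟨ +-mono-≤ S₁.length-dropped-vertices S₂.length-dropped-vertices ⟩
      sum (map dropped₁ classes) * k + sum (map dropped₂ classes) * k
        ≡⟨ *-distribʳ-+ k (sum (map dropped₁ classes)) _ ⟨
      (sum (map dropped₁ classes) + sum (map dropped₂ classes)) * k
        ≡⟨ cong (_* k) (sum-map-+ dropped₁ dropped₂ classes) ⟨
      sum (map (λ t → dropped₁ t + dropped₂ t) classes) * k
        ≡⟨ cong (λ xs → sum xs * k) (map-cong dropped≡discrepancy classes) ⟩
      sum (map discrepancy classes) * k ∎
      where
      open ≤-Reasoning
      dropped₁ dropped₂ : Class G₁ G₂ k → ℕ
      dropped₁ t = length (drop (length (components₂ t)) (components₁ t))
      dropped₂ t = length (drop (length (components₁ t)) (components₂ t))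
      dropped≡discrepancy : ∀ t → dropped₁ t + dropped₂ t ≡ discrepancy t
      dropped≡discrepancy t = trans
        (cong₂ _+_ (length-drop (length (components₂ t)) (components₁ t)) (length-drop (length (components₁ t)) (components₂ t)))
        (sym (∣m-n∣≡m∸n+n∸m (length (components₁ t)) (length (components₂ t))))

    edits-bound : ∀ {d} → MaxDegreeAtMost d G₁ → MaxDegreeAtMost d G₂ →
      edits G₁ G₂ π ≤ sum (map discrepancy classes) * k * d
    edits-bound {d} deg₁ deg₂ = begin
      edits G₁ G₂ π
        ≤⟨ edits≤ G₁ G₂ π deg₁ deg₂ S₁.kept-vertices S₁.dropped-vertices S₁.kept++dropped↭allFin
             (kept-preserved π (proj₂ relabelling ∘ ∈-++⁺ˡ)) ⟩
      length S₁.dropped-vertices * (d + d)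
        ≡⟨ *-distribˡ-+ (length S₁.dropped-vertices) d d ⟩
      length S₁.dropped-vertices * d + length S₁.dropped-vertices * d
        ≡⟨ cong (λ w → length S₁.dropped-vertices * d + w * d) length-dropped-equal ⟩
      length S₁.dropped-vertices * d + length S₂.dropped-vertices * d
        ≡⟨ *-distribʳ-+ d (length S₁.dropped-vertices) _ ⟨
      (length S₁.dropped-vertices + length S₂.dropped-vertices) * d
        ≤⟨ *-monoˡ-≤ d dropped-total ⟩
      sum (map discrepancy classes) * k * d ∎
      where open ≤-Reasoning

  edit-bound : ∀ {n k d} (G₁ G₂ : Graph n) → MaxDegreeAtMost d G₁ → MaxDegreeAtMost d G₂ →
    ComponentsAtMost k G₁ → ComponentsAtMost k G₂ →
    ∀ Fs → Representatives k Fs → ∀ c₁ c₂ → CntVec G₁ Fs c₁ → CntVec G₂ Fs c₂ →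
    ∃ λ π → edits G₁ G₂ π ≤ l1 c₁ c₂ * k * d
  edit-bound {k = k} {d} G₁ G₂ deg₁ deg₂ small₁ small₂ Fs reps c₁ c₂ cnt₁ cnt₂
    with classes-of G₁ G₂ Fs (proj₁ reps) cnt₁ cnt₂
  ... | classes , keys , l1≡ = π , subst (λ l → edits G₁ G₂ π ≤ l * k * d) (sym l1≡) (edits-bound deg₁ deg₂)
    where open Matching small₁ small₂ reps classes keys

module Arithmetic where

  open import Data.Nat using (ℕ; suc; _*_; _≤_; z≤n; s≤s; NonZero; >-nonZero; pred)
  open import Data.Nat.Properties using (*-monoˡ-≤; *-monoʳ-≤; *-identityʳ; m≤n*m; module ≤-Reasoning)
  open import Data.Nat.Tactic.RingSolver using (solve-∀)
  open import Data.Integer as ℤ using (+_; -[1+_]; +≤+)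
  import Data.Integer.Properties as ℤ
  open import Data.Rational as ℚ using (ℚ; mkℚ; 0ℚ; toℚᵘ)
  import Data.Rational.Properties as ℚ
  open import Data.Rational.Unnormalised as ℚᵘ using (ℚᵘ; mkℚᵘ; *≤*; *≡*; _≃_)
  import Data.Rational.Unnormalised.Properties as ℚᵘ
  open import Relation.Binary.PropositionalEquality
  open import Defs using (normalise)

  _/suc_ : ℕ → ℕ → ℚᵘ
  a /suc b = mkℚᵘ (+ a) b

  /suc-≤⇒ : ∀ {a b c e} → a /suc b ℚᵘ.≤ c /suc e → a * suc e ≤ c * suc b
  /suc-≤⇒ {a} {b} {c} {e} (*≤* ≤ℤ) = ℤ.drop‿+≤+ (subst₂ ℤ._≤_ (sym (ℤ.pos-* a (suc e))) (sym (ℤ.pos-* c (suc b))) ≤ℤ)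

  ≤⇒/suc-≤ : ∀ {a b c e} → a * suc e ≤ c * suc b → a /suc b ℚᵘ.≤ c /suc e
  ≤⇒/suc-≤ {a} {b} {c} {e} ≤ℕ = *≤* (subst₂ ℤ._≤_ (ℤ.pos-* a (suc e)) (ℤ.pos-* c (suc b)) (+≤+ ≤ℕ))

  toℚᵘ-*-ℕ : ∀ x a {p q} → toℚᵘ x ≃ p /suc q → toℚᵘ (x ℚ.* (+ a ℚ./ 1)) ≃ (p * a) /suc (pred (suc q * 1))
  toℚᵘ-*-ℕ x a {p} {q} x≃ = ℚᵘ.≃-trans (ℚ.toℚᵘ-homo-* x (+ a ℚ./ 1))
    (ℚᵘ.≃-trans (ℚᵘ.*-cong x≃ (ℚ.toℚᵘ-fromℚᵘ (a /suc 0)))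
    (*≡* (cong (ℤ._* (+ (suc q * 1))) (sym (ℤ.pos-* p a)))))

  cross-multiplied≤ : ∀ {e l k d p n Q} → 1 ≤ d → e ≤ l * k * d → l * Q ≤ p * n → e * Q ≤ p * k * d * (d * n)
  cross-multiplied≤ {e} {l} {k} {d} {p} {n} {Q} 1≤d e≤lkd lQ≤pn = begin
    e * Q               ≤⟨ *-monoˡ-≤ Q e≤lkd ⟩
    l * k * d * Q       ≡⟨ move-Q l k d Q ⟩
    l * Q * (k * d)     ≤⟨ *-monoˡ-≤ (k * d) lQ≤pn ⟩
    p * n * (k * d)     ≡⟨ move-n p n k d ⟩
    p * k * d * n       ≤⟨ *-monoʳ-≤ (p * k * d) (m≤n*m n d {{>-nonZero 1≤d}}) ⟩
    p * k * d * (d * n) ∎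
    where
    open ≤-Reasoning
    move-Q : ∀ l k d Q → l * k * d * Q ≡ l * Q * (k * d)
    move-Q = solve-∀
    move-n : ∀ p n k d → p * n * (k * d) ≡ p * k * d * n
    move-n = solve-∀

  normalise≤ : (n d k e l : ℕ) .{{_ : NonZero n}} .{{_ : NonZero d}} (γ : ℚ) → 0ℚ ℚ.≤ γ →
    e ≤ l * k * d → (+ l ℚ./ 1) ℚ.≤ γ ℚ.* (+ n ℚ./ 1) →
    normalise d n e ℚ.≤ γ ℚ.* (+ k ℚ./ 1) ℚ.* (+ d ℚ./ 1)
  normalise≤ (suc _) (suc _) k e l (mkℚ -[1+ _ ] _ _) (ℚ.*≤* ()) _ _
  normalise≤ n@(suc _) d@(suc _) k e l γ@(mkℚ (+ p) q _) _ e≤lkd l≤γn = ℚ.toℚᵘ-cancel-≤ (begin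
    toℚᵘ (normalise d n e)                   ≃⟨ ℚ.toℚᵘ-fromℚᵘ (e /suc pred (d * n)) ⟩
    e /suc pred (d * n)                      ≤⟨ ≤⇒/suc-≤ (subst (λ x → e * x ≤ p * k * d * (d * n)) (sym Q*1*1≡Q) eQ≤pkddn) ⟩
    (p * k * d) /suc pred (Q * 1 * 1)        ≃⟨ toℚᵘ-*-ℕ (γ ℚ.* (+ k ℚ./ 1)) d (toℚᵘ-*-ℕ γ k ℚᵘ.≃-refl) ⟨
    toℚᵘ (γ ℚ.* (+ k ℚ./ 1) ℚ.* (+ d ℚ./ 1)) ∎)
    where
    open ℚᵘ.≤-Reasoning
    Q = suc q
    Q*1*1≡Q : Q * 1 * 1 ≡ Q
    Q*1*1≡Q = trans (*-identityʳ (Q * 1)) (*-identityʳ Q)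
    lQ≤pn : l * Q ≤ p * n
    lQ≤pn = subst₂ _≤_ (cong (l *_) (*-identityʳ Q)) (*-identityʳ (p * n))
      (/suc-≤⇒ (ℚᵘ.≤-respˡ-≃ (ℚ.toℚᵘ-fromℚᵘ (l /suc 0)) (ℚᵘ.≤-respʳ-≃ (toℚᵘ-*-ℕ γ n ℚᵘ.≃-refl) (ℚ.toℚᵘ-mono-≤ l≤γn))))
    eQ≤pkddn : e * Q ≤ p * k * d * (d * n)
    eQ≤pkddn = cross-multiplied≤ {e} {l} {k} {d} {p} {n} {Q} (s≤s z≤n) e≤lkd lQ≤pn

open import Defs
open import Data.Nat using (ℕ; NonZero)
open import Data.List using (List)
open import Data.Integer using (+_)
open import Data.Rational using (ℚ; 0ℚ; _≤_; _*_; _/_)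
open import Data.Product using (_,_)
open Combinatorics using (edit-bound)
open Arithmetic using (normalise≤)

claim2p4 : (n d k : ℕ) .{{_ : NonZero n}} .{{_ : NonZero d}} .{{_ : NonZero k}}
    (γ : ℚ) → 0ℚ ≤ γ →
    (G₁ G₂ : Graph n) →
    MaxDegreeAtMost d G₁ → MaxDegreeAtMost d G₂ →
    ComponentsAtMost k G₁ → ComponentsAtMost k G₂ →
    (Fs : List Graphs) → Representatives k Fs →
    (c₁ c₂ : List ℕ) → CntVec G₁ Fs c₁ → CntVec G₂ Fs c₂ →
    (+ l1 c₁ c₂ / 1) ≤ γ * (+ n / 1) →
    DistAtMost d G₁ G₂ (γ * (+ k / 1) * (+ d / 1))
claim2p4 n d k γ 0≤γ G₁ G₂ deg₁ deg₂ small₁ small₂ Fs reps c₁ c₂ cnt₁ cnt₂ l1≤γn =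
  let π , edits≤l1kd = edit-bound G₁ G₂ deg₁ deg₂ small₁ small₂ Fs reps c₁ c₂ cnt₁ cnt₂
  in π , normalise≤ n d k (edits G₁ G₂ π) (l1 c₁ c₂) γ 0≤γ edits≤l1kd l1≤γn
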